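{- Kleisli composition need not have left units: there exists a set $X$ such that there is no relation $\iota:X\rightharpoonup\wp(X)$ satisfying $\iota\circ\alpha=\alpha$ for all relations $\alpha:X\rightharpoonup\wp(X)$.
   Context: A relation $\alpha:X\rightharpoonup Y$ is a subset of $X\times Y$; relational composition is written by juxtaposition. For $\beta:Y\rightharpoonup\wp(Z)$, the Kleisli lifting $\beta_\circ:\wp(Y)\rightharpoonup\wp(Z)$ is given by $(B,A)\in\beta_\circ$ iff $A=\bigcup\{C\in\wp(Z)\mid\exists b\in B.\,(b,C)\in\beta\}$, and the Kleisli composition of $\alpha:X\rightharpoonup\wp(Y)$ and $\beta:Y\rightharpoonup\wp(Z)$ is $\alpha\circ\beta=\alpha\beta_\circ$. -}

module Defs where

open import Data.Nat using (ℕ)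
open import Data.Fin using (Fin)
open import Data.Fin.Subset using (Subset; _∈_)
open import Data.Product using (Σ; ∃; _×_)
open import Function.Bundles using (_⇔_)

-- The finite set X = Fin n; its power set ℘(X) is Subset n (decidable
-- subsets, which for a finite set are all subsets).

Rel⇀ : Set → Set → Set₁
Rel⇀ X Y = X → Y → Set

-- Kleisli lifting: β : Y ⇀ ℘(Z) (Y = Fin m, Z = Fin k) gives
-- β∘ : ℘(Y) ⇀ ℘(Z),  (B , A) ∈ β∘  iff  A = ⋃ { C | ∃ b ∈ B . (b , C) ∈ β }.
lift : ∀ {m k} → Rel⇀ (Fin m) (Subset k) → Rel⇀ (Subset m) (Subset k)
lift {m} {k} β B A =
  (z : Fin k) → (z ∈ A) ⇔ (Σ (Fin m) λ b → b ∈ B × Σ (Subset k) λ C → β b C × z ∈ C)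

_⨾_ : ∀ {X Y Z : Set} → Rel⇀ X Y → Rel⇀ Y Z → Rel⇀ X Z
(α ⨾ β) x z = ∃ λ y → α x y × β y z

_∘K_ : ∀ {n m k} → Rel⇀ (Fin n) (Subset m) → Rel⇀ (Fin m) (Subset k)
     → Rel⇀ (Fin n) (Subset k)
α ∘K β = α ⨾ lift β

_≐R_ : ∀ {X Y : Set} → Rel⇀ X Y → Rel⇀ X Y → Set
_≐R_ {X} {Y} α β = (x : X) → (y : Y) → α x y ⇔ β x y

{-# OPTIONS --safe #-}
module Submission where

open import Defs
open import Data.Nat using (ℕ)
open import Data.Fin using (Fin; zero)
open import Data.Fin.Subset using (Subset) renaming (⊥ to ∅)
open import Data.Fin.Subset.Properties using (∉⊥)
open import Data.Empty using (⊥; ⊥-elim)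
open import Data.Unit using (⊤; tt)
open import Data.Product using (∃; Σ; _,_)
open import Function.Bundles using (Equivalence; mk⇔)
open import Relation.Binary.Construct.Constant.Core using (Const)
open import Relation.Nullary using (¬_)

-- Testing a left unit ι against the full relation shows that ι relates each
-- x to some B.  But the empty relation lifts every B to the empty union ∅, so
-- ι ∘K Const ⊥ relates x to ∅, whereas Const ⊥ relates nothing.

lift-Const⊥ : ∀ {m k} (B : Subset m) → lift {k = k} (Const ⊥) B ∅
lift-Const⊥ B z = mk⇔ (λ z∈∅ → ⊥-elim (∉⊥ z∈∅)) (λ ())

∘K-Const⊥ : ∀ {n m k} (ι : Rel⇀ (Fin n) (Subset m)) {x : Fin n} →
            ∃ (ι x) → (ι ∘K Const {B = Subset k} ⊥) x ∅
∘K-Const⊥ ι (B , ιxB) = B , ιxB , lift-Const⊥ B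

∘K-dom : ∀ {n m k} (ι : Rel⇀ (Fin n) (Subset m)) (α : Rel⇀ (Fin m) (Subset k))
         {x : Fin n} {A : Subset k} → (ι ∘K α) x A → ∃ (ι x)
∘K-dom ι α (B , ιxB , _) = B , ιxB

no-left-unit : ∀ {n} → Fin n →
               ¬ (Σ (Rel⇀ (Fin n) (Subset n)) λ ι →
                   (α : Rel⇀ (Fin n) (Subset n)) → (ι ∘K α) ≐R α)
no-left-unit {n} x (ι , unit) =
  Equivalence.to (unit (Const ⊥) x ∅) (∘K-Const⊥ ι ι-total)
  where
  ι-total : ∃ (ι x)
  ι-total = ∘K-dom ι (Const {B = Subset n} ⊤) (Equivalence.from (unit (Const ⊤) x ∅) tt)

proposition4p3 : Σ ℕ λ n →
    ¬ (Σ (Rel⇀ (Fin n) (Subset n)) λ ι →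
        (α : Rel⇀ (Fin n) (Subset n)) → (ι ∘K α) ≐R α)
proposition4p3 = 1 , no-left-unit zero
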